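{- Let $K$ be a field, $M=M_3(K)$ with matrix units $e_{ij}$, and $L=M\otimes M\otimes M$. Let $\Phi_1,\Phi_2,\Phi_3,\Phi_4:L\to L$ be the linear maps $\Phi_1=T(\pi_{23},\pi_{13},1)$, $\Phi_2=T(\pi_{23},1,\pi_{23})$, $\Phi_3(x\otimes y\otimes z)=y^t\varepsilon_2\otimes\varepsilon_2x^t\otimes z^t$, $\Phi_4(x\otimes y\otimes z)=\varepsilon_1z\pi_{12}\otimes\pi_{12}x\pi_{12}\varepsilon_1\otimes\varepsilon_1\pi_{12}y\varepsilon_1$. Then the group $G=\langle\Phi_1,\Phi_2,\Phi_3,\Phi_4\rangle$ is isomorphic to $S_4$.
   Context: $T(a,b,c)$ for $a,b,c\in GL_3(K)$ is the linear map $x\otimes y\otimes z\mapsto axb^{ -1}\otimes byc^{ -1}\otimes cza^{ -1}$. $\pi_{12}=e_{12}+e_{21}+e_{33}$, $\pi_{13}=e_{13}+e_{22}+e_{31}$, $\pi_{23}=e_{11}+e_{23}+e_{32}$ are permutation matrices, $\varepsilon_1=\mathrm{diag}(-1,1,1)$, $\varepsilon_2=\mathrm{diag}(1,-1,1)$, and $x^t$ is the transpose. -}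

module Defs where

open import Level using (Level; _⊔_)
open import Algebra.Bundles using (CommutativeRing)
open import Data.Fin using (Fin; zero; suc; _≟_)
open import Data.Product using (_×_; _,_; proj₁; proj₂; ∃; Σ)
open import Data.List using (List; []; _∷_)
open import Relation.Nullary using (¬_; does)
open import Data.Bool using (if_then_else_)
open import Function using (id; _∘′_)

record Field (c ℓ : Level) : Set (Level.suc (c ⊔ ℓ)) where
  field
    commutativeRing : CommutativeRing c ℓ
  open CommutativeRing commutativeRing public
  field
    0≉1     : ¬ (0# ≈ 1#)
    inverse : ∀ x → ¬ (x ≈ 0#) → ∃ λ y → (x * y) ≈ 1#

module Over {c ℓ : Level} (F : Field c ℓ) where
  open Field F using (Carrier; _≈_; _+_; _*_; -_; 0#; 1#)

  Σ3 : (Fin 3 → Carrier) → Carrier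
  Σ3 f = f zero + (f (suc zero) + f (suc (suc zero)))

  M : Set c
  M = Fin 3 → Fin 3 → Carrier

  infixl 7 _·_
  _·_ : M → M → M
  (A · B) i j = Σ3 (λ k → A i k * B k j)

  _ᵗ : M → M
  (A ᵗ) i j = A j i

  δ : Fin 3 → Fin 3 → Carrier
  δ i j = if does (i ≟ j) then 1# else 0#

  𝟙 : M
  𝟙 = δ

  e : Fin 3 → Fin 3 → M
  e i j k l = δ i k * δ j l

  0F 1F 2F : Fin 3
  0F = zero
  1F = suc zero
  2F = suc (suc zero)

  π₁₂ π₁₃ π₂₃ ε₁ ε₂ : M
  π₁₂ = λ i j → ((e 0F 1F i j + e 1F 0F i j) + e 2F 2F i j)
  π₁₃ = λ i j → ((e 0F 2F i j + e 1F 1F i j) + e 2F 0F i j)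
  π₂₃ = λ i j → ((e 0F 0F i j + e 1F 2F i j) + e 2F 1F i j)
  ε₁  = λ i j → ((- e 0F 0F i j) + e 1F 1F i j) + e 2F 2F i j
  ε₂  = λ i j → (e 0F 0F i j + (- e 1F 1F i j)) + e 2F 2F i j

  -- L = M ⊗ M ⊗ M, written in coordinates w.r.t. the basis
  -- e_p ⊗ e_q ⊗ e_r  (p, q, r positions (row, column) in a 3×3 matrix)
  Idx : Set
  Idx = Fin 3 × Fin 3

  L : Set c
  L = Idx → Idx → Idx → Carrier

  ΣIdx : (Idx → Carrier) → Carrier
  ΣIdx g = Σ3 λ i → Σ3 λ j → g (i , j)

  E : Idx → M
  E (i , j) = e i j

  _⊗_⊗_ : M → M → M → L
  (x ⊗ y ⊗ z) p q r = (x (proj₁ p) (proj₂ p) * y (proj₁ q) (proj₂ q)) * z (proj₁ r) (proj₂ r)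

  -- the unique linear map L → L whose value on e_p ⊗ e_q ⊗ e_r is f (e_p) (e_q) (e_r)
  ext : (M → M → M → L) → L → L
  ext f v p q r =
    ΣIdx λ p′ → ΣIdx λ q′ → ΣIdx λ r′ → v p′ q′ r′ * f (E p′) (E q′) (E r′) p q r

  -- T(a,b,c) : x⊗y⊗z ↦ a x b⁻¹ ⊗ b y c⁻¹ ⊗ c z a⁻¹, for permutation
  -- matrices a, b, c (whose inverse is the transpose)
  T : M → M → M → L → L
  T a b c = ext λ x y z → (a · x · b ᵗ) ⊗ (b · y · c ᵗ) ⊗ (c · z · a ᵗ)

  Φ₁ Φ₂ Φ₃ Φ₄ : L → L
  Φ₁ = T π₂₃ π₁₃ 𝟙
  Φ₂ = T π₂₃ 𝟙 π₂₃
  Φ₃ = ext λ x y z → (y ᵗ · ε₂) ⊗ (ε₂ · x ᵗ) ⊗ (z ᵗ)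
  Φ₄ = ext λ x y z → (ε₁ · z · π₁₂) ⊗ (π₁₂ · x · π₁₂ · ε₁) ⊗ (ε₁ · π₁₂ · y · ε₁)

  Φ : Fin 4 → L → L
  Φ zero = Φ₁
  Φ (suc zero) = Φ₂
  Φ (suc (suc zero)) = Φ₃
  Φ (suc (suc (suc zero))) = Φ₄

  infix 4 _≋_
  _≋_ : (L → L) → (L → L) → Set (c ⊔ ℓ)
  f ≋ g = ∀ v p q r → f v p q r ≈ g v p q r

  eval : List (Fin 4) → L → L
  eval [] = id
  eval (i ∷ w) = Φ i ∘′ eval w

  InG : (L → L) → Set (c ⊔ ℓ)
  InG f = ∃ λ (w : List (Fin 4)) → f ≋ eval w

-- Every Φᵢ sends a basis tensor e_p ⊗ e_q ⊗ e_r to ± a basis tensor: it permutes the three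
-- tensor slots, moves the matrix position within each slot, and multiplies by a product of one
-- sign per slot.  Such signed monomial maps are given by finite data and compose as data, so the
-- group G can be computed combinatorially.  The computation does not depend on K because the
-- matrices involved have entries 0 and ±1 and no two nonzero terms are ever added; this is
-- checked by evaluating the defining formulas over {0, ±1, unknown}.
-- Fix a word in the generators for each element of S₄ (sending Φ₁, Φ₂, Φ₃, Φ₄ to (14)(23),
-- (12)(34), (12), (142)).  These 24 normal words are closed under left multiplication by the
-- generators, so every word acts as the normal word of its permutation; hence σ ↦ (its normal
-- word) is a homomorphism onto G.  It is injective because the 24 normal words send one fixed
-- basis tensor to 24 different basis tensors.

module Submission where

open import Defs
open import Level using (Level; Lift; lift)
open import Data.Fin using (Fin)
open import Data.Fin.Permutation
  using (Permutation′; _∘ₚ_; _≈_; _⟨$⟩ʳ_; _⟨$⟩ˡ_; inverseˡ; inverseʳ; id; transpose)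
open import Data.Product using (Σ; ∃; _×_; _,_; proj₁; proj₂; map; map₁; map₂; swap)
open import Function using (_∘′_; _∘_)

import Algebra.Properties.CommutativeMonoid.Sum as CommutativeMonoidSum
import Algebra.Properties.Ring as RingProperties
open import Data.Bool using (Bool; true; false; if_then_else_)
open import Data.Empty using (⊥; ⊥-elim)
open import Data.Fin.Patterns using (0F; 1F; 2F; 3F)
import Data.Fin.Permutation.Components as PermutationComponents
open import Data.Fin.Properties using (_≟_; all?)
open import Data.List using (List; []; _∷_; _++_)
open import Data.List.Membership.Propositional using (_∈_; find)
open import Data.List.Relation.Unary.All as All using (All)
open import Data.List.Relation.Unary.Any using (Any; here; any?)
import Data.List.Properties as List
import Data.Product.Properties as Product
open import Data.Sign using (Sign; opposite) renaming (+ to +ˢ; - to -ˢ; _*_ to _*ˢ_)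
import Data.Sign.Properties as Sign
open import Data.Unit using (⊤; tt)
open import Data.Vec.Functional using (Vector)
import Data.Vec.Functional as Vec
open import Relation.Binary using (DecidableEquality)
open import Relation.Binary.PropositionalEquality
  using (_≡_; _≢_; refl; sym; trans; cong; cong₂; subst; module ≡-Reasoning)
open import Relation.Nullary using (Dec; yes; no; does)
open import Relation.Nullary.Decidable
  using (map′; from-yes; _→-dec_; _×-dec_; dec-true; dec-false; decidable-stable)

open CommutativeMonoidSum Sign.*-commutativeMonoid
  using () renaming (sum to ∏; ∑-distrib-+ to ∏-distrib-*; sum-permute to ∏-permute; sum-cong-≗ to ∏-cong)

Idx : Set
Idx = Fin 3 × Fin 3

_≟ᵢ_ : DecidableEquality Idx
_≟ᵢ_ = Product.≡-dec _≟_ _≟_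

triple : ∀ {a} {A : Set a} → A → A → A → Vector A 3
triple x y z = x Vec.∷ y Vec.∷ z Vec.∷ Vec.[]

triple-η : ∀ {a} {A : Set a} (t : Vector A 3) → ∀ k → triple (t 0F) (t 1F) (t 2F) k ≡ t k
triple-η t 0F = refl
triple-η t 1F = refl
triple-η t 2F = refl

triple-map : ∀ {a b} {A : Set a} {B : Set b} (f : A → B) (x y z : A) →
  ∀ k → triple (f x) (f y) (f z) k ≡ f (triple x y z k)
triple-map f x y z 0F = refl
triple-map f x y z 1F = refl
triple-map f x y z 2F = refl

-- Encodes the linear map act m of L defined over the field below: the entry of act m v at the
-- positions out = (p , q , r) is ± the entry of v at target m out, where output slot k reads
-- input slot source ⟨$⟩ʳ k at position index k (out k), and ± is the product of the signs
-- sign k (out k).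
record Monomial : Set where
  field
    source : Permutation′ 3
    index  : Fin 3 → Idx → Idx
    sign   : Fin 3 → Idx → Sign
open Monomial

target : Monomial → Vector Idx 3 → Vector Idx 3
target m out j = index m k (out k)
  where k = source m ⟨$⟩ˡ j

signAt : Monomial → Vector Idx 3 → Sign
signAt m out = ∏ λ k → sign m k (out k)

unit : Monomial
unit = record { source = id ; index = λ _ x → x ; sign = λ _ _ → +ˢ }

infixl 7 _•_
_•_ : Monomial → Monomial → Monomial
d • e = record
  { source = source d ∘ₚ source e
  ; index  = λ k x → index e (source d ⟨$⟩ʳ k) (index d k x)
  ; sign   = λ k x → sign d k x *ˢ sign e (source d ⟨$⟩ʳ k) (index d k x)
  }

target-• : ∀ d e out j → target e (target d out) j ≡ target (d • e) out j
target-• d e out j = cong (λ k′ → index e k′ (index d k (out k))) (sym (inverseʳ (source d)))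
  where k = source d ⟨$⟩ˡ (source e ⟨$⟩ˡ j)

signAt-• : ∀ d e out → signAt d out *ˢ signAt e (target d out) ≡ signAt (d • e) out
signAt-• d e out = begin
  signAt d out *ˢ ∏ (λ j → sign e j (target d out j))
    ≡⟨ cong (signAt d out *ˢ_) (∏-permute (λ j → sign e j (target d out j)) (source d)) ⟩
  signAt d out *ˢ ∏ (λ k → sign e (source d ⟨$⟩ʳ k) (target d out (source d ⟨$⟩ʳ k)))
    ≡⟨ cong (signAt d out *ˢ_) (∏-cong λ k →
         cong (λ k′ → sign e (source d ⟨$⟩ʳ k) (index d k′ (out k′))) (inverseˡ (source d) {k})) ⟩
  signAt d out *ˢ ∏ (λ k → sign e (source d ⟨$⟩ʳ k) (index d k (out k)))
    ≡⟨ ∏-distrib-* (λ k → sign d k (out k)) (λ k → sign e (source d ⟨$⟩ʳ k) (index d k (out k))) ⟨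
  signAt (d • e) out ∎
  where open ≡-Reasoning

infix 4 _≅_
record _≅_ (d e : Monomial) : Set where
  constructor same
  field
    source≡ : ∀ j → source d ⟨$⟩ˡ j ≡ source e ⟨$⟩ˡ j
    index≡  : ∀ k x → index d k x ≡ index e k x
    sign≡   : ∀ k x → sign d k x ≡ sign e k x

allIdx? : {P : Idx → Set} → (∀ x → Dec (P x)) → Dec (∀ x → P x)
allIdx? P? = map′ (λ h (i , j) → h i j) (λ h i j → h (i , j)) (all? λ i → all? λ j → P? (i , j))

_≅?_ : ∀ d e → Dec (d ≅ e)
d ≅? e = map′ (λ (s , i , g) → same s i g) (λ (same s i g) → s , i , g)
  ((all? λ j → source d ⟨$⟩ˡ j ≟ source e ⟨$⟩ˡ j)
   ×-dec (all? λ k → allIdx? λ x → index d k x ≟ᵢ index e k x)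
   ×-dec (all? λ k → allIdx? λ x → sign d k x Sign.≟ sign e k x))

-- Matrix entries up to sign; unknown stands for a sum of two nonzero entries, about which the
-- abstraction claims nothing (so that it is sound in every characteristic).
data Val : Set where
  0ᵛ      : Val
  sgn     : Sign → Val
  unknown : Val

_≟ᵛ_ : DecidableEquality Val
0ᵛ ≟ᵛ 0ᵛ = yes refl
sgn s ≟ᵛ sgn t with s Sign.≟ t
... | yes refl = yes refl
... | no s≢t = no λ { refl → s≢t refl }
unknown ≟ᵛ unknown = yes refl
0ᵛ ≟ᵛ sgn _ = no λ ()
0ᵛ ≟ᵛ unknown = no λ ()
sgn _ ≟ᵛ 0ᵛ = no λ ()
sgn _ ≟ᵛ unknown = no λ ()
unknown ≟ᵛ 0ᵛ = no λ ()
unknown ≟ᵛ sgn _ = no λ ()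

infixl 6 _+ᵛ_
_+ᵛ_ : Val → Val → Val
0ᵛ +ᵛ b = b
sgn s +ᵛ 0ᵛ = sgn s
_ +ᵛ _ = unknown

infixl 7 _*ᵛ_
_*ᵛ_ : Val → Val → Val
0ᵛ *ᵛ _ = 0ᵛ
sgn _ *ᵛ 0ᵛ = 0ᵛ
unknown *ᵛ 0ᵛ = 0ᵛ
sgn s *ᵛ sgn t = sgn (s *ˢ t)
_ *ᵛ _ = unknown

-ᵛ_ : Val → Val
-ᵛ 0ᵛ = 0ᵛ
-ᵛ sgn s = sgn (opposite s)
-ᵛ unknown = unknown

Mᵛ : Set
Mᵛ = Fin 3 → Fin 3 → Val

δᵛ : Fin 3 → Fin 3 → Val
δᵛ i j = if does (i ≟ j) then sgn +ˢ else 0ᵛ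

eᵛ : Fin 3 → Fin 3 → Mᵛ
eᵛ i j k l = δᵛ i k *ᵛ δᵛ j l

infixl 7 _·ᵛ_
_·ᵛ_ : Mᵛ → Mᵛ → Mᵛ
(A ·ᵛ B) i j = A i 0F *ᵛ B 0F j +ᵛ (A i 1F *ᵛ B 1F j +ᵛ A i 2F *ᵛ B 2F j)

Eᵛ : Idx → Mᵛ
Eᵛ (i , j) = eᵛ i j

data MatrixExpr : Set where
  var       : MatrixExpr
  𝟙ᵉ        : MatrixExpr
  eᵉ        : Fin 3 → Fin 3 → MatrixExpr
  ⊖_ _ᵀ     : MatrixExpr → MatrixExpr
  _⊕_ _⊙_   : MatrixExpr → MatrixExpr → MatrixExpr

infixl 6 _⊕_
infixl 7 _⊙_

evalᵛ : MatrixExpr → Mᵛ → Mᵛ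
evalᵛ var X = X
evalᵛ 𝟙ᵉ X = δᵛ
evalᵛ (eᵉ i j) X = eᵛ i j
evalᵛ (⊖ a) X i j = -ᵛ evalᵛ a X i j
evalᵛ (a ᵀ) X i j = evalᵛ a X j i
evalᵛ (a ⊕ b) X i j = evalᵛ a X i j +ᵛ evalᵛ b X i j
evalᵛ (a ⊙ b) X = evalᵛ a X ·ᵛ evalᵛ b X

π₁₂ᵉ π₁₃ᵉ π₂₃ᵉ ε₁ᵉ ε₂ᵉ : MatrixExpr
π₁₂ᵉ = eᵉ 0F 1F ⊕ eᵉ 1F 0F ⊕ eᵉ 2F 2F
π₁₃ᵉ = eᵉ 0F 2F ⊕ eᵉ 1F 1F ⊕ eᵉ 2F 0F
π₂₃ᵉ = eᵉ 0F 0F ⊕ eᵉ 1F 2F ⊕ eᵉ 2F 1F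
ε₁ᵉ = ⊖ eᵉ 0F 0F ⊕ eᵉ 1F 1F ⊕ eᵉ 2F 2F
ε₂ᵉ = eᵉ 0F 0F ⊕ ⊖ eᵉ 1F 1F ⊕ eᵉ 2F 2F

monomialEntry : (Idx → Idx) → (Idx → Sign) → Idx → Idx → Val
monomialEntry β s p′ p = if does (p′ ≟ᵢ β p) then sgn (s p) else 0ᵛ

Represents : MatrixExpr → (Idx → Idx) → (Idx → Sign) → Set
Represents a β s = ∀ p′ p → evalᵛ a (Eᵛ p′) (proj₁ p) (proj₂ p) ≡ monomialEntry β s p′ p

represents? : ∀ a β s → Dec (Represents a β s)
represents? a β s = allIdx? λ p′ → allIdx? λ p →
  evalᵛ a (Eᵛ p′) (proj₁ p) (proj₂ p) ≟ᵛ monomialEntry β s p′ p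

formula : Fin 4 → Fin 3 → MatrixExpr
formula 0F 0F = π₂₃ᵉ ⊙ var ⊙ π₁₃ᵉ ᵀ
formula 0F 1F = π₁₃ᵉ ⊙ var ⊙ 𝟙ᵉ ᵀ
formula 0F 2F = 𝟙ᵉ ⊙ var ⊙ π₂₃ᵉ ᵀ
formula 1F 0F = π₂₃ᵉ ⊙ var ⊙ 𝟙ᵉ ᵀ
formula 1F 1F = 𝟙ᵉ ⊙ var ⊙ π₂₃ᵉ ᵀ
formula 1F 2F = π₂₃ᵉ ⊙ var ⊙ π₂₃ᵉ ᵀ
formula 2F 0F = var ᵀ ⊙ ε₂ᵉ
formula 2F 1F = ε₂ᵉ ⊙ var ᵀ
formula 2F 2F = var ᵀ
formula 3F 0F = ε₁ᵉ ⊙ var ⊙ π₁₂ᵉ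
formula 3F 1F = π₁₂ᵉ ⊙ var ⊙ π₁₂ᵉ ⊙ ε₁ᵉ
formula 3F 2F = ε₁ᵉ ⊙ π₁₂ᵉ ⊙ var ⊙ ε₁ᵉ

σ₁₂ σ₁₃ σ₂₃ : Fin 3 → Fin 3
σ₁₂ = PermutationComponents.transpose 0F 1F
σ₁₃ = PermutationComponents.transpose 0F 2F
σ₂₃ = PermutationComponents.transpose 1F 2F

εsign : Fin 3 → Fin 3 → Sign
εsign i j = if does (i ≟ j) then -ˢ else +ˢ

generator : Fin 4 → Monomial
generator 0F = record
  { source = id
  ; index  = λ { 0F → map σ₂₃ σ₁₃ ; 1F → map₁ σ₁₃ ; 2F → map₂ σ₂₃ }
  ; sign   = λ _ _ → +ˢ
  }
generator 1F = record
  { source = id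
  ; index  = λ { 0F → map₁ σ₂₃ ; 1F → map₂ σ₂₃ ; 2F → map σ₂₃ σ₂₃ }
  ; sign   = λ _ _ → +ˢ
  }
generator 2F = record
  { source = transpose 0F 1F
  ; index  = λ _ → swap
  ; sign   = λ { 0F (i , j) → εsign 1F j ; 1F (i , j) → εsign 1F i ; 2F _ → +ˢ }
  }
generator 3F = record
  { source = transpose 0F 1F ∘ₚ transpose 1F 2F
  ; index  = λ { 0F → map₂ σ₁₂ ; 1F → map σ₁₂ σ₁₂ ; 2F → map₁ σ₁₂ }
  ; sign   = λ { 0F (i , j) → εsign 0F i ; 1F (i , j) → εsign 0F j ; 2F (i , j) → εsign 0F i *ˢ εsign 0F j }
  }

generator-represents : ∀ i k → Represents (formula i k) (index (generator i) k) (sign (generator i) k)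
generator-represents = from-yes (all? λ i → all? λ k →
  represents? (formula i k) (index (generator i) k) (sign (generator i) k))

Word : Set
Word = List (Fin 4)

compile : Word → Monomial
compile [] = unit
compile (i ∷ w) = generator i • compile w

-- σ ∘ₚ τ applies σ first, so perm (i ∷ w) applies perm w first, as eval (i ∷ w) = Φ i ∘ eval w does.
generatorPerm : Fin 4 → Permutation′ 4
generatorPerm 0F = transpose 0F 3F ∘ₚ transpose 1F 2F
generatorPerm 1F = transpose 0F 1F ∘ₚ transpose 2F 3F
generatorPerm 2F = transpose 0F 1F
generatorPerm 3F = transpose 0F 3F ∘ₚ transpose 0F 1F

perm : Word → Permutation′ 4
perm [] = id
perm (i ∷ w) = perm w ∘ₚ generatorPerm i

perm-++ : ∀ u w → perm (u ++ w) ≈ perm w ∘ₚ perm u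
perm-++ [] w x = refl
perm-++ (i ∷ u) w x = cong (generatorPerm i ⟨$⟩ʳ_) (perm-++ u w x)

normalWords : List Word
normalWords =
  [] ∷ (0F ∷ []) ∷ (1F ∷ []) ∷ (2F ∷ []) ∷ (3F ∷ []) ∷
  (0F ∷ 2F ∷ []) ∷ (1F ∷ 0F ∷ []) ∷ (1F ∷ 3F ∷ []) ∷ (2F ∷ 0F ∷ []) ∷ (2F ∷ 1F ∷ []) ∷
  (2F ∷ 3F ∷ []) ∷ (3F ∷ 0F ∷ []) ∷ (3F ∷ 1F ∷ []) ∷ (3F ∷ 2F ∷ []) ∷ (3F ∷ 3F ∷ []) ∷
  (2F ∷ 1F ∷ 3F ∷ []) ∷ (2F ∷ 3F ∷ 0F ∷ []) ∷ (2F ∷ 3F ∷ 1F ∷ []) ∷ (3F ∷ 0F ∷ 2F ∷ []) ∷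
  (3F ∷ 1F ∷ 3F ∷ []) ∷ (3F ∷ 2F ∷ 0F ∷ []) ∷ (3F ∷ 2F ∷ 1F ∷ []) ∷ (3F ∷ 3F ∷ 0F ∷ []) ∷
  (3F ∷ 3F ∷ 1F ∷ []) ∷ []

Table : Set
Table = Vector (Fin 4) 4

table : Fin 4 → Fin 4 → Fin 4 → Fin 4 → Table
table a b c d = a Vec.∷ b Vec.∷ c Vec.∷ d Vec.∷ Vec.[]

tableOf : Permutation′ 4 → Table
tableOf σ = table (σ ⟨$⟩ʳ 0F) (σ ⟨$⟩ʳ 1F) (σ ⟨$⟩ʳ 2F) (σ ⟨$⟩ʳ 3F)

tableOf-correct : ∀ σ i → tableOf σ i ≡ σ ⟨$⟩ʳ i
tableOf-correct σ 0F = refl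
tableOf-correct σ 1F = refl
tableOf-correct σ 2F = refl
tableOf-correct σ 3F = refl

_Realises_ : Word → Table → Set
w Realises t = ∀ i → perm w ⟨$⟩ʳ i ≡ t i

wordFor : Table → Word
wordFor t with any? (λ w → all? λ i → perm w ⟨$⟩ʳ i ≟ t i) normalWords
... | yes realised = proj₁ (find realised)
... | no _ = []   -- junk value, reached only for tables that are not permutations

wordFor-∈ : ∀ t → wordFor t ∈ normalWords
wordFor-∈ t with any? (λ w → all? λ i → perm w ⟨$⟩ʳ i ≟ t i) normalWords
... | yes realised = proj₁ (proj₂ (find realised))
... | no _ = here refl

IsInjective : Table → Set
IsInjective t = ∀ i j → t i ≡ t j → i ≡ j

normalWords-complete : ∀ a b c d → IsInjective (table a b c d) → Any (_Realises table a b c d) normalWords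
normalWords-complete = from-yes (all? λ a → all? λ b → all? λ c → all? λ d →
  (all? λ i → all? λ j → (table a b c d i ≟ table a b c d j) →-dec (i ≟ j))
  →-dec any? (λ w → all? λ i → perm w ⟨$⟩ʳ i ≟ table a b c d i) normalWords)

wordFor-realises : ∀ a b c d → IsInjective (table a b c d) → wordFor (table a b c d) Realises table a b c d
wordFor-realises a b c d injective
  with any? (λ w → all? λ i → perm w ⟨$⟩ʳ i ≟ table a b c d i) normalWords
... | yes realised = proj₂ (proj₂ (find realised))
... | no unrealised = ⊥-elim (unrealised (normalWords-complete a b c d injective))

wordOf : Permutation′ 4 → Word
wordOf σ = wordFor (tableOf σ)

wordOf-∈ : ∀ σ → wordOf σ ∈ normalWords
wordOf-∈ σ = wordFor-∈ (tableOf σ)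

wordOf-cong : ∀ σ τ → σ ≈ τ → wordOf σ ≡ wordOf τ
wordOf-cong σ τ σ≈τ =
  cong₂ (λ (a , b) (c , d) → wordFor (table a b c d))
    (cong₂ _,_ (σ≈τ 0F) (σ≈τ 1F)) (cong₂ _,_ (σ≈τ 2F) (σ≈τ 3F))

tableOf-injective : ∀ σ → IsInjective (tableOf σ)
tableOf-injective σ i j same-entry = begin
  i                  ≡⟨ inverseˡ σ ⟨
  σ ⟨$⟩ˡ (σ ⟨$⟩ʳ i)   ≡⟨ cong (σ ⟨$⟩ˡ_) σi≡σj ⟩
  σ ⟨$⟩ˡ (σ ⟨$⟩ʳ j)   ≡⟨ inverseˡ σ ⟩
  j                  ∎
  where
  open ≡-Reasoning
  σi≡σj = trans (sym (tableOf-correct σ i)) (trans same-entry (tableOf-correct σ j))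

perm-wordOf : ∀ σ → perm (wordOf σ) ≈ σ
perm-wordOf σ i = trans (wordFor-realises _ _ _ _ (tableOf-injective σ) i) (tableOf-correct σ i)

normalForm : Word → Word
normalForm w = wordOf (perm w)

normalForm-∈ : ∀ w → normalForm w ∈ normalWords
normalForm-∈ w = wordOf-∈ (perm w)

normalForm-∷ : ∀ i w → normalForm (i ∷ normalForm w) ≡ normalForm (i ∷ w)
normalForm-∷ i w = wordOf-cong (perm (i ∷ normalForm w)) (perm (i ∷ w)) λ x →
  cong (generatorPerm i ⟨$⟩ʳ_) (perm-wordOf (perm w) x)

wordOf-∘ₚ : ∀ σ τ → wordOf (σ ∘ₚ τ) ≡ normalForm (wordOf τ ++ wordOf σ)
wordOf-∘ₚ σ τ = wordOf-cong (σ ∘ₚ τ) (perm (wordOf τ ++ wordOf σ)) λ x → begin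
  τ ⟨$⟩ʳ (σ ⟨$⟩ʳ x)                           ≡⟨ perm-wordOf τ _ ⟨
  perm (wordOf τ) ⟨$⟩ʳ (σ ⟨$⟩ʳ x)               ≡⟨ cong (perm (wordOf τ) ⟨$⟩ʳ_) (perm-wordOf σ x) ⟨
  perm (wordOf τ) ⟨$⟩ʳ (perm (wordOf σ) ⟨$⟩ʳ x)  ≡⟨ perm-++ (wordOf τ) (wordOf σ) x ⟨
  perm (wordOf τ ++ wordOf σ) ⟨$⟩ʳ x            ∎
  where open ≡-Reasoning

normalWords-closed : ∀ i → All (λ u → compile (i ∷ u) ≅ compile (normalForm (i ∷ u))) normalWords
normalWords-closed = from-yes (all? λ i →
  All.all? (λ u → compile (i ∷ u) ≅? compile (normalForm (i ∷ u))) normalWords)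

-- The 24 normal words send the basis tensor at these positions to 24 different positions.
probe : Vector Idx 3
probe = triple (0F , 0F) (0F , 0F) (0F , 1F)

SameProbe : Word → Word → Set
SameProbe u w = ∀ j → target (compile u) probe j ≡ target (compile w) probe j

normalWords-separated : All (λ u → All (λ w → SameProbe u w → u ≡ w) normalWords) normalWords
normalWords-separated = from-yes (All.all? (λ u → All.all? (λ w →
  (all? λ j → target (compile u) probe j ≟ᵢ target (compile w) probe j) →-dec List.≡-dec _≟_ u w)
  normalWords) normalWords)

probe-determines : ∀ σ τ → SameProbe (wordOf σ) (wordOf τ) → σ ≈ τ
probe-determines σ τ same-target x = begin
  σ ⟨$⟩ʳ x                ≡⟨ perm-wordOf σ x ⟨
  perm (wordOf σ) ⟨$⟩ʳ x  ≡⟨ cong (λ w → perm w ⟨$⟩ʳ x) wordOf-σ≡wordOf-τ ⟩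
  perm (wordOf τ) ⟨$⟩ʳ x  ≡⟨ perm-wordOf τ x ⟩
  τ ⟨$⟩ʳ x                ∎
  where
  open ≡-Reasoning
  wordOf-σ≡wordOf-τ = All.lookup (All.lookup normalWords-separated (wordOf-∈ σ)) (wordOf-∈ τ) same-target

module _ {c ℓ : Level} (F : Field c ℓ) where
  open Field F
    using (Carrier; _+_; _*_; -_; 0#; 1#; 0≉1; setoid; ring
          ; +-cong; +-congˡ; +-congʳ; +-identityˡ; +-identityʳ; *-cong; *-congˡ; *-congʳ
          ; *-identityˡ; *-identityʳ; *-assoc; *-comm; zeroˡ; zeroʳ; -‿cong)
    renaming (_≈_ to _≈ₖ_; refl to ≈-refl; sym to ≈-sym; trans to ≈-trans; reflexive to ≈-reflexive)
  open Over F
    using (π₁₂; π₁₃; π₂₃; ε₁; ε₂; M; _·_; _ᵗ; δ; 𝟙; e; E; L; Σ3; ΣIdx; _⊗_⊗_; ext; Φ; _≋_; eval; InG)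
  open RingProperties ring using (-1*x≈-x; -‿involutive; -0#≈0#)
  open import Relation.Binary.Reasoning.Setoid setoid

  ⟦_⟧ : Sign → Carrier
  ⟦ +ˢ ⟧ = 1#
  ⟦ -ˢ ⟧ = - 1#

  ⟦*⟧ : ∀ s t → ⟦ s *ˢ t ⟧ ≈ₖ ⟦ s ⟧ * ⟦ t ⟧
  ⟦*⟧ +ˢ t = ≈-sym (*-identityˡ ⟦ t ⟧)
  ⟦*⟧ -ˢ +ˢ = ≈-sym (*-identityʳ (- 1#))
  ⟦*⟧ -ˢ -ˢ = ≈-sym (≈-trans (-1*x≈-x (- 1#)) (-‿involutive 1#))

  ⟦opposite⟧ : ∀ s → ⟦ opposite s ⟧ ≈ₖ - ⟦ s ⟧
  ⟦opposite⟧ +ˢ = ≈-refl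
  ⟦opposite⟧ -ˢ = ≈-sym (-‿involutive 1#)

  ⟦⟧≉0 : ∀ s → ⟦ s ⟧ ≈ₖ 0# → ⊥
  ⟦⟧≉0 +ˢ 1≈0 = 0≉1 (≈-sym 1≈0)
  ⟦⟧≉0 -ˢ -1≈0 = 0≉1 (≈-sym (≈-trans (≈-sym (-‿involutive 1#)) (≈-trans (-‿cong -1≈0) -0#≈0#)))

  ⟦∏⟧ : ∀ (f : Vector Sign 3) → ⟦ ∏ f ⟧ ≈ₖ (⟦ f 0F ⟧ * ⟦ f 1F ⟧) * ⟦ f 2F ⟧
  ⟦∏⟧ f = begin
    ⟦ f 0F *ˢ (f 1F *ˢ (f 2F *ˢ +ˢ)) ⟧  ≡⟨ cong (λ s → ⟦ f 0F *ˢ (f 1F *ˢ s) ⟧) (Sign.*-identityʳ (f 2F)) ⟩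
    ⟦ f 0F *ˢ (f 1F *ˢ f 2F) ⟧         ≈⟨ ⟦*⟧ (f 0F) (f 1F *ˢ f 2F) ⟩
    ⟦ f 0F ⟧ * ⟦ f 1F *ˢ f 2F ⟧        ≈⟨ *-congˡ (⟦*⟧ (f 1F) (f 2F)) ⟩
    ⟦ f 0F ⟧ * (⟦ f 1F ⟧ * ⟦ f 2F ⟧)   ≈⟨ *-assoc _ _ _ ⟨
    (⟦ f 0F ⟧ * ⟦ f 1F ⟧) * ⟦ f 2F ⟧   ∎

  infix 4 _∼_ _∼ᴹ_
  _∼_ : Carrier → Val → Set ℓ
  x ∼ 0ᵛ = x ≈ₖ 0#
  x ∼ sgn s = x ≈ₖ ⟦ s ⟧
  x ∼ unknown = Lift ℓ ⊤

  ∼-respˡ : ∀ {x y} a → x ≈ₖ y → y ∼ a → x ∼ a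
  ∼-respˡ 0ᵛ x≈y y∼a = ≈-trans x≈y y∼a
  ∼-respˡ (sgn s) x≈y y∼a = ≈-trans x≈y y∼a
  ∼-respˡ unknown _ _ = lift tt

  +-∼ : ∀ {x y} a b → x ∼ a → y ∼ b → x + y ∼ a +ᵛ b
  +-∼ {x} {y} 0ᵛ b x≈0 y∼b = ∼-respˡ b (≈-trans (+-congʳ x≈0) (+-identityˡ y)) y∼b
  +-∼ {x} (sgn s) 0ᵛ x∼s y≈0 = ≈-trans (+-cong x∼s y≈0) (+-identityʳ ⟦ s ⟧)
  +-∼ (sgn s) (sgn t) _ _ = lift tt
  +-∼ (sgn s) unknown _ _ = lift tt
  +-∼ unknown b _ _ = lift tt

  *-∼ : ∀ {x y} a b → x ∼ a → y ∼ b → x * y ∼ a *ᵛ b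
  *-∼ {x} {y} 0ᵛ b x≈0 _ = ≈-trans (*-congʳ x≈0) (zeroˡ y)
  *-∼ {x} (sgn s) 0ᵛ _ y≈0 = ≈-trans (*-congˡ y≈0) (zeroʳ x)
  *-∼ {x} unknown 0ᵛ _ y≈0 = ≈-trans (*-congˡ y≈0) (zeroʳ x)
  *-∼ (sgn s) (sgn t) x∼s y∼t = ≈-trans (*-cong x∼s y∼t) (≈-sym (⟦*⟧ s t))
  *-∼ (sgn s) unknown _ _ = lift tt
  *-∼ unknown (sgn t) _ _ = lift tt
  *-∼ unknown unknown _ _ = lift tt

  -‿∼ : ∀ {x} a → x ∼ a → - x ∼ -ᵛ a
  -‿∼ 0ᵛ x≈0 = ≈-trans (-‿cong x≈0) -0#≈0#
  -‿∼ (sgn s) x∼s = ≈-trans (-‿cong x∼s) (≈-sym (⟦opposite⟧ s))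
  -‿∼ unknown _ = lift tt

  _∼ᴹ_ : M → Mᵛ → Set ℓ
  A ∼ᴹ S = ∀ i j → A i j ∼ S i j

  δ-∼ : ∀ i j → δ i j ∼ δᵛ i j
  δ-∼ i j with does (i ≟ j)
  ... | true  = ≈-refl
  ... | false = ≈-refl

  e-∼ : ∀ i j → e i j ∼ᴹ eᵛ i j
  e-∼ i j k l = *-∼ (δᵛ i k) (δᵛ j l) (δ-∼ i k) (δ-∼ j l)

  ·-∼ : ∀ {A B S T} → A ∼ᴹ S → B ∼ᴹ T → A · B ∼ᴹ S ·ᵛ T
  ·-∼ {S = S} {T} A∼S B∼T i j =
    +-∼ (S i 0F *ᵛ T 0F j) (S i 1F *ᵛ T 1F j +ᵛ S i 2F *ᵛ T 2F j) (entry 0F)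
      (+-∼ (S i 1F *ᵛ T 1F j) (S i 2F *ᵛ T 2F j) (entry 1F) (entry 2F))
    where entry = λ k → *-∼ (S i k) (T k j) (A∼S i k) (B∼T k j)

  evalᴹ : MatrixExpr → M → M
  evalᴹ var x = x
  evalᴹ 𝟙ᵉ x = 𝟙
  evalᴹ (eᵉ i j) x = e i j
  evalᴹ (⊖ a) x i j = - evalᴹ a x i j
  evalᴹ (a ᵀ) x = evalᴹ a x ᵗ
  evalᴹ (a ⊕ b) x i j = evalᴹ a x i j + evalᴹ b x i j
  evalᴹ (a ⊙ b) x = evalᴹ a x · evalᴹ b x

  evalᴹ-∼ : ∀ a {x X} → x ∼ᴹ X → evalᴹ a x ∼ᴹ evalᵛ a X
  evalᴹ-∼ var x∼X = x∼X
  evalᴹ-∼ 𝟙ᵉ x∼X = δ-∼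
  evalᴹ-∼ (eᵉ i j) x∼X = e-∼ i j
  evalᴹ-∼ (⊖ a) {X = X} x∼X i j = -‿∼ (evalᵛ a X i j) (evalᴹ-∼ a x∼X i j)
  evalᴹ-∼ (a ᵀ) x∼X i j = evalᴹ-∼ a x∼X j i
  evalᴹ-∼ (a ⊕ b) {X = X} x∼X i j =
    +-∼ (evalᵛ a X i j) (evalᵛ b X i j) (evalᴹ-∼ a x∼X i j) (evalᴹ-∼ b x∼X i j)
  evalᴹ-∼ (a ⊙ b) {X = X} x∼X = ·-∼ {S = evalᵛ a X} {evalᵛ b X} (evalᴹ-∼ a x∼X) (evalᴹ-∼ b x∼X)

  IsMonomial : (M → M) → (Idx → Idx) → (Idx → Sign) → Set ℓ
  IsMonomial G β s = ∀ p′ p → G (E p′) (proj₁ p) (proj₂ p) ∼ monomialEntry β s p′ p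

  represents⇒isMonomial : ∀ {a β s} → Represents a β s → IsMonomial (evalᴹ a) β s
  represents⇒isMonomial {a} represents (i , j) p =
    subst (_ ∼_) (represents (i , j) p) (evalᴹ-∼ a (e-∼ i j) (proj₁ p) (proj₂ p))

  module _ {G β s} (G-monomial : IsMonomial G β s) where

    isMonomial-on : ∀ p → G (E (β p)) (proj₁ p) (proj₂ p) ≈ₖ ⟦ s p ⟧
    isMonomial-on p =
      subst (_ ∼_) (cong (λ b → if b then sgn (s p) else 0ᵛ) (dec-true (β p ≟ᵢ β p) refl)) (G-monomial (β p) p)

    isMonomial-off : ∀ {p′} p → p′ ≢ β p → G (E p′) (proj₁ p) (proj₂ p) ≈ₖ 0#
    isMonomial-off {p′} p p′≢βp =
      subst (_ ∼_) (cong (λ b → if b then sgn (s p) else 0ᵛ) (dec-false (p′ ≟ᵢ β p) p′≢βp)) (G-monomial p′ p)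

  Σ3-single : ∀ f k → (∀ i → i ≢ k → f i ≈ₖ 0#) → Σ3 f ≈ₖ f k
  Σ3-single f 0F vanish =
    ≈-trans (+-congˡ (≈-trans (+-cong (vanish 1F λ ()) (vanish 2F λ ())) (+-identityˡ 0#))) (+-identityʳ (f 0F))
  Σ3-single f 1F vanish =
    ≈-trans (+-cong (vanish 0F λ ()) (≈-trans (+-congˡ (vanish 2F λ ())) (+-identityʳ (f 1F)))) (+-identityˡ (f 1F))
  Σ3-single f 2F vanish =
    ≈-trans (+-cong (vanish 0F λ ()) (≈-trans (+-congʳ (vanish 1F λ ())) (+-identityˡ (f 2F)))) (+-identityˡ (f 2F))

  ΣIdx-single : ∀ g t → (∀ x → x ≢ t → g x ≈ₖ 0#) → ΣIdx g ≈ₖ g t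
  ΣIdx-single g (i₀ , j₀) vanish =
    ≈-trans (Σ3-single _ i₀ λ i i≢i₀ → ≈-trans (Σ3-single _ 0F λ j _ → off j i≢i₀) (off 0F i≢i₀))
            (Σ3-single _ j₀ λ j j≢j₀ → vanish (i₀ , j) (j≢j₀ ∘ cong proj₂))
    where
    off : ∀ {i} j → i ≢ i₀ → g (i , j) ≈ₖ 0#
    off j i≢i₀ = vanish (_ , j) (i≢i₀ ∘ cong proj₁)

  ΣIdx-zero : ∀ g → (∀ x → g x ≈ₖ 0#) → ΣIdx g ≈ₖ 0#
  ΣIdx-zero g vanish = ≈-trans (ΣIdx-single g (0F , 0F) λ x _ → vanish x) (vanish (0F , 0F))

  ΣIdx³-single : ∀ (h : Idx → Idx → Idx → Carrier) (t : Vector Idx 3) →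
    (∀ x y z j → triple x y z j ≢ t j → h x y z ≈ₖ 0#) →
    ΣIdx (λ x → ΣIdx λ y → ΣIdx λ z → h x y z) ≈ₖ h (t 0F) (t 1F) (t 2F)
  ΣIdx³-single h t vanish =
    ≈-trans (ΣIdx-single (λ x → ΣIdx λ y → ΣIdx λ z → h x y z) (t 0F) λ x x≢t₀ →
               ΣIdx-zero (λ y → ΣIdx λ z → h x y z) λ y → ΣIdx-zero (h x y) λ z → vanish x y z 0F x≢t₀)
    (≈-trans (ΣIdx-single (λ y → ΣIdx λ z → h (t 0F) y z) (t 1F) λ y y≢t₁ →
               ΣIdx-zero (h (t 0F) y) λ z → vanish (t 0F) y z 1F y≢t₁)
             (ΣIdx-single (h (t 0F) (t 1F)) (t 2F) λ z z≢t₂ → vanish (t 0F) (t 1F) z 2F z≢t₂))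

  *³-zero : ∀ (a : Vector Carrier 3) k → a k ≈ₖ 0# → (a 0F * a 1F) * a 2F ≈ₖ 0#
  *³-zero a 0F a₀≈0 = ≈-trans (*-congʳ (≈-trans (*-congʳ a₀≈0) (zeroˡ (a 1F)))) (zeroˡ (a 2F))
  *³-zero a 1F a₁≈0 = ≈-trans (*-congʳ (≈-trans (*-congˡ a₁≈0) (zeroʳ (a 0F)))) (zeroˡ (a 2F))
  *³-zero a 2F a₂≈0 = ≈-trans (*-congˡ a₂≈0) (zeroʳ (a 0F * a 1F))

  monomialTensor : Permutation′ 3 → (Fin 3 → M → M) → M → M → M → L
  monomialTensor ρ G x y z = G 0F (w (ρ ⟨$⟩ʳ 0F)) ⊗ G 1F (w (ρ ⟨$⟩ʳ 1F)) ⊗ G 2F (w (ρ ⟨$⟩ʳ 2F))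
    where w = triple x y z

  infix 8 _at_
  _at_ : L → Vector Idx 3 → Carrier
  v at t = v (t 0F) (t 1F) (t 2F)

  at-cong : ∀ v {t t′} → (∀ j → t j ≡ t′ j) → v at t ≡ v at t′
  at-cong v t≗t′ = cong₂ (λ a (b , c) → v a b c) (t≗t′ 0F) (cong₂ _,_ (t≗t′ 1F) (t≗t′ 2F))

  act : Monomial → L → L
  act m v p q r = ⟦ signAt m out ⟧ * v at target m out
    where out = triple p q r

  module _ (m : Monomial) (G : Fin 3 → M → M) (G-monomial : ∀ k → IsMonomial (G k) (index m k) (sign m k))
           (p q r : Idx) where
    private
      ρ = source m
      out = triple p q r
      t = target m out

    monomialTensor-off : ∀ x y z j → triple x y z j ≢ t j → monomialTensor ρ G (E x) (E y) (E z) p q r ≈ₖ 0#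
    monomialTensor-off x y z j off-target = *³-zero factor k
      (≈-trans (≈-reflexive (cong (λ A → G k A _ _) reads-slot-j))
               (isMonomial-off {G = G k} (G-monomial k) (out k) off-target))
      where
      k = ρ ⟨$⟩ˡ j
      factor : Vector Carrier 3
      factor k′ = G k′ (triple (E x) (E y) (E z) (ρ ⟨$⟩ʳ k′)) (proj₁ (out k′)) (proj₂ (out k′))
      reads-slot-j : triple (E x) (E y) (E z) (ρ ⟨$⟩ʳ k) ≡ E (triple x y z j)
      reads-slot-j = trans (triple-map E x y z (ρ ⟨$⟩ʳ k)) (cong (E ∘ triple x y z) (inverseʳ ρ))

    monomialTensor-on : monomialTensor ρ G (E (t 0F)) (E (t 1F)) (E (t 2F)) p q r ≈ₖ ⟦ signAt m out ⟧
    monomialTensor-on = begin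
      (factor 0F * factor 1F) * factor 2F                     ≈⟨ *-cong (*-cong (on 0F) (on 1F)) (on 2F) ⟩
      (⟦ s 0F ⟧ * ⟦ s 1F ⟧) * ⟦ s 2F ⟧                          ≈⟨ ⟦∏⟧ s ⟨
      ⟦ signAt m out ⟧                                        ∎
      where
      s : Vector Sign 3
      s k = sign m k (out k)
      factor : Vector Carrier 3
      factor k = G k (triple (E (t 0F)) (E (t 1F)) (E (t 2F)) (ρ ⟨$⟩ʳ k)) (proj₁ (out k)) (proj₂ (out k))
      picks-target : ∀ k → triple (E (t 0F)) (E (t 1F)) (E (t 2F)) (ρ ⟨$⟩ʳ k) ≡ E (index m k (out k))
      picks-target k = trans (triple-map E (t 0F) (t 1F) (t 2F) (ρ ⟨$⟩ʳ k))
        (cong E (trans (triple-η t (ρ ⟨$⟩ʳ k)) (cong (λ k′ → index m k′ (out k′)) (inverseˡ ρ))))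
      on : ∀ k → factor k ≈ₖ ⟦ s k ⟧
      on k = ≈-trans (≈-reflexive (cong (λ A → G k A _ _) (picks-target k)))
        (isMonomial-on {G = G k} (G-monomial k) (out k))

    ext-monomial : ∀ v → ext (monomialTensor ρ G) v p q r ≈ₖ act m v p q r
    ext-monomial v = begin
      ext (monomialTensor ρ G) v p q r                                 ≈⟨ ΣIdx³-single h t vanish ⟩
      v at t * monomialTensor ρ G (E (t 0F)) (E (t 1F)) (E (t 2F)) p q r ≈⟨ *-congˡ monomialTensor-on ⟩
      v at t * ⟦ signAt m out ⟧                                       ≈⟨ *-comm _ _ ⟩
      act m v p q r                                                   ∎
      where
      h : Idx → Idx → Idx → Carrier
      h x y z = v x y z * monomialTensor ρ G (E x) (E y) (E z) p q r
      vanish : ∀ x y z j → triple x y z j ≢ t j → h x y z ≈ₖ 0#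
      vanish x y z j off-target = ≈-trans (*-congˡ (monomialTensor-off x y z j off-target)) (zeroʳ _)

  act-cong : ∀ m {v w : L} → (∀ a b c → v a b c ≈ₖ w a b c) → ∀ p q r → act m v p q r ≈ₖ act m w p q r
  act-cong m v≈w p q r = *-congˡ (v≈w _ _ _)

  act-≅ : ∀ {d e} → d ≅ e → ∀ v p q r → act d v p q r ≡ act e v p q r
  act-≅ {d} {e} (same source≡ index≡ sign≡) v p q r =
    cong₂ (λ s u → ⟦ s ⟧ * u) (∏-cong λ k → sign≡ k (out k))
      (at-cong v λ j → trans (cong (λ k → index d k (out k)) (source≡ j)) (index≡ _ _))
    where out = triple p q r

  act-• : ∀ d e v p q r → act d (act e v) p q r ≈ₖ act (d • e) v p q r
  act-• d e v p q r = begin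
    ⟦ signAt d out ⟧ * (⟦ signAt e t ⟧ * v at target e (triple (t 0F) (t 1F) (t 2F)))
      ≡⟨ cong (λ u → ⟦ signAt d out ⟧ * (⟦ signAt e t ⟧ * u)) (at-cong v target-η) ⟩
    ⟦ signAt d out ⟧ * (⟦ signAt e t ⟧ * v at target e t)
      ≈⟨ *-assoc _ _ _ ⟨
    (⟦ signAt d out ⟧ * ⟦ signAt e t ⟧) * v at target e t
      ≈⟨ *-congʳ (⟦*⟧ (signAt d out) (signAt e t)) ⟨
    ⟦ signAt d out *ˢ signAt e t ⟧ * v at target e t
      ≡⟨ cong₂ (λ s u → ⟦ s ⟧ * u) (signAt-• d e out) (at-cong v (target-• d e out)) ⟩
    act (d • e) v p q r ∎
    where
    out = triple p q r
    t = target d out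
    target-η : ∀ j → target e (triple (t 0F) (t 1F) (t 2F)) j ≡ target e t j
    target-η j = cong (index e (source e ⟨$⟩ˡ j)) (triple-η t (source e ⟨$⟩ˡ j))

  generatorTensor : Fin 4 → M → M → M → L
  generatorTensor i = monomialTensor (source (generator i)) (evalᴹ ∘ formula i)

  cong-ext : ∀ f g → f ≡ g → ext f ≡ ext g
  cong-ext f g = cong ext

  -- The trilinear maps are written out as in Defs so that Φ i and ext are compared through the
  -- argument of ext; otherwise conversion checking unfolds ext into sums of 729 terms.
  Φ-tensor : ∀ i → Φ i ≡ ext (generatorTensor i)
  Φ-tensor 0F =
    cong-ext (λ x y z → (π₂₃ · x · π₁₃ ᵗ) ⊗ (π₁₃ · y · 𝟙 ᵗ) ⊗ (𝟙 · z · π₂₃ ᵗ)) (generatorTensor 0F) refl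
  Φ-tensor 1F =
    cong-ext (λ x y z → (π₂₃ · x · 𝟙 ᵗ) ⊗ (𝟙 · y · π₂₃ ᵗ) ⊗ (π₂₃ · z · π₂₃ ᵗ)) (generatorTensor 1F) refl
  Φ-tensor 2F =
    cong-ext (λ x y z → (y ᵗ · ε₂) ⊗ (ε₂ · x ᵗ) ⊗ (z ᵗ)) (generatorTensor 2F) refl
  Φ-tensor 3F =
    cong-ext (λ x y z → (ε₁ · z · π₁₂) ⊗ (π₁₂ · x · π₁₂ · ε₁) ⊗ (ε₁ · π₁₂ · y · ε₁)) (generatorTensor 3F) refl

  Φ-act : ∀ i → Φ i ≋ act (generator i)
  Φ-act i v p q r = ≈-trans (≈-reflexive (cong (λ f → f v p q r) (Φ-tensor i)))
    (ext-monomial (generator i) (evalᴹ ∘ formula i) formula-monomial p q r v)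
    where
    formula-monomial : ∀ k → IsMonomial (evalᴹ (formula i k)) (index (generator i) k) (sign (generator i) k)
    formula-monomial k = represents⇒isMonomial {formula i k} (generator-represents i k)

  eval-act : ∀ w → eval w ≋ act (compile w)
  eval-act [] v p q r = ≈-sym (*-identityˡ (v p q r))
  eval-act (i ∷ w) v p q r = begin
    Φ i (eval w v) p q r                    ≈⟨ Φ-act i (eval w v) p q r ⟩
    act (generator i) (eval w v) p q r      ≈⟨ act-cong (generator i) (eval-act w v) p q r ⟩
    act (generator i) (act (compile w) v) p q r ≈⟨ act-• (generator i) (compile w) v p q r ⟩
    act (compile (i ∷ w)) v p q r           ∎

  act-compile-normalForm : ∀ w → act (compile w) ≋ act (compile (normalForm w))
  act-compile-normalForm [] v p q r = ≈-refl
  act-compile-normalForm (i ∷ w) v p q r = begin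
    act (generator i • compile w) v p q r
      ≈⟨ act-• (generator i) (compile w) v p q r ⟨
    act (generator i) (act (compile w) v) p q r
      ≈⟨ act-cong (generator i) (act-compile-normalForm w v) p q r ⟩
    act (generator i) (act (compile (normalForm w)) v) p q r
      ≈⟨ act-• (generator i) (compile (normalForm w)) v p q r ⟩
    act (compile (i ∷ normalForm w)) v p q r
      ≡⟨ act-≅ (All.lookup (normalWords-closed i) (normalForm-∈ w)) v p q r ⟩
    act (compile (normalForm (i ∷ normalForm w))) v p q r
      ≡⟨ cong (λ u → act (compile u) v p q r) (normalForm-∷ i w) ⟩
    act (compile (normalForm (i ∷ w))) v p q r ∎

  eval-normalForm : ∀ w → eval w ≋ eval (normalForm w)
  eval-normalForm w v p q r = begin
    eval w v p q r                         ≈⟨ eval-act w v p q r ⟩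
    act (compile w) v p q r                ≈⟨ act-compile-normalForm w v p q r ⟩
    act (compile (normalForm w)) v p q r   ≈⟨ eval-act (normalForm w) v p q r ⟨
    eval (normalForm w) v p q r            ∎

  eval-++ : ∀ u w → eval (u ++ w) ≡ eval u ∘′ eval w
  eval-++ [] w = refl
  eval-++ (i ∷ u) w = cong (Φ i ∘′_) (eval-++ u w)

  _≟³_ : DecidableEquality (Idx × Idx × Idx)
  _≟³_ = Product.≡-dec _≟ᵢ_ (Product.≡-dec _≟ᵢ_ _≟ᵢ_)

  indicator : Idx × Idx × Idx → L
  indicator t a b c = if does ((a , b , c) ≟³ t) then 1# else 0#

  point : Vector Idx 3 → Idx × Idx × Idx
  point t = t 0F , t 1F , t 2F

  point-injective : ∀ {t t′ : Vector Idx 3} → point t ≡ point t′ → ∀ j → t j ≡ t′ j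
  point-injective t≡t′ 0F = cong proj₁ t≡t′
  point-injective t≡t′ 1F = cong (proj₁ ∘ proj₂) t≡t′
  point-injective t≡t′ 2F = cong (proj₂ ∘ proj₂) t≡t′

  act-determines-target : ∀ d e p q r → (∀ v → act d v p q r ≈ₖ act e v p q r) →
    point (target d (triple p q r)) ≡ point (target e (triple p q r))
  act-determines-target d e p q r same-act = decidable-stable (t ≟³ t′) λ t≢t′ → ⟦⟧≉0 (signAt d out) (begin
    ⟦ signAt d out ⟧                  ≈⟨ *-identityʳ _ ⟨
    ⟦ signAt d out ⟧ * 1#             ≡⟨ cong (scaled d) (dec-true (t ≟³ t) refl) ⟨
    act d (indicator t) p q r         ≈⟨ same-act (indicator t) ⟩
    act e (indicator t) p q r         ≡⟨ cong (scaled e) (dec-false (t′ ≟³ t) (t≢t′ ∘ sym)) ⟩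
    ⟦ signAt e out ⟧ * 0#             ≈⟨ zeroʳ _ ⟩
    0#                                ∎)
    where
    out = triple p q r
    t = point (target d out)
    t′ = point (target e out)
    scaled : Monomial → Bool → Carrier
    scaled m b = ⟦ signAt m out ⟧ * (if b then 1# else 0#)

  φ : Permutation′ 4 → L → L
  φ σ = eval (wordOf σ)

  φ-∘ₚ : ∀ σ τ → φ (σ ∘ₚ τ) ≋ (φ τ ∘′ φ σ)
  φ-∘ₚ σ τ v p q r = begin
    eval (wordOf (σ ∘ₚ τ)) v p q r                   ≡⟨ cong (λ w → eval w v p q r) (wordOf-∘ₚ σ τ) ⟩
    eval (normalForm (wordOf τ ++ wordOf σ)) v p q r ≈⟨ eval-normalForm (wordOf τ ++ wordOf σ) v p q r ⟨
    eval (wordOf τ ++ wordOf σ) v p q r              ≡⟨ cong (λ f → f v p q r) (eval-++ (wordOf τ) (wordOf σ)) ⟩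
    φ τ (φ σ v) p q r                                ∎

  φ-injective : ∀ σ τ → φ σ ≋ φ τ → σ ≈ τ
  φ-injective σ τ φσ≋φτ = probe-determines σ τ (point-injective (act-determines-target
    (compile (wordOf σ)) (compile (wordOf τ)) (probe 0F) (probe 1F) (probe 2F) λ v →
      ≈-trans (≈-sym (eval-act (wordOf σ) v _ _ _)) (≈-trans (φσ≋φτ v _ _ _) (eval-act (wordOf τ) v _ _ _))))

  φ-∈G : ∀ σ → InG (φ σ)
  φ-∈G σ = wordOf σ , λ _ _ _ _ → ≈-refl

  φ-generator : ∀ i → φ (generatorPerm i) ≋ Φ i
  φ-generator i v p q r = begin
    eval (wordOf (generatorPerm i)) v p q r  ≡⟨ cong (λ w → eval w v p q r) wordOf-generator ⟩
    eval (normalForm (i ∷ [])) v p q r      ≈⟨ eval-normalForm (i ∷ []) v p q r ⟨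
    Φ i v p q r                             ∎
    where
    wordOf-generator = wordOf-cong (generatorPerm i) (perm (i ∷ [])) λ _ → refl

proposition5p4 : ∀ {c ℓ : Level} (F : Field c ℓ) → let open Over F in
    Σ (Permutation′ 4 → L → L) λ φ →
      (∀ σ τ → φ (σ ∘ₚ τ) ≋ (φ τ ∘′ φ σ))
      × (∀ σ τ → φ σ ≋ φ τ → σ ≈ τ)
      × (∀ σ → InG (φ σ))
      × (∀ (i : Fin 4) → ∃ λ σ → φ σ ≋ Φ i)
proposition5p4 F = φ F , φ-∘ₚ F , φ-injective F , φ-∈G F , λ i → generatorPerm i , φ-generator F i
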